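{- Let $G$ be an ordered abelian group with finite spines, $p$ a prime, $\{H_i\}_{i<\kappa}$ ($\kappa\leq \omega$) a collection of definable convex subgroups with $H_i\subsetneq H_j$ whenever $i<j$, and $\{e_i\}_{i<\kappa}\subseteq \mathbb{N}\cup\{0,\infty\}$. Assume that for every $i_0<\kappa$, \[\Big[ \bigcap_{i_0\neq i<\kappa}(H_i +p^{e_i}G):\bigcap_{i<\kappa}(H_i+p^{e_i}G)\Big]=\infty.\] Then: (1) $e_{i}\neq 0$ for every $i<\kappa$, and if $e_{i_0}=\infty$ then $i_0$ is the maximal element of $\kappa$; (2) for $i,j<\kappa$, $i<j$ if and only if $e_i<e_j$; (3) $\kappa\leq k_p+1$, and in particular $\kappa$ is finite.
   Context: Convention: $H+p^\infty G=H$. For $n\in\mathbb N$ and $a\in G$: if $a\in nG$ put $H_n(a)=\{0\}$; otherwise $H_n(a)$ is the largest convex subgroup $H$ with $a\notin H+nG$; finite spines means $\{H_p(a):a\in G\}$ is finite for all primes $p$. "Definable" means definable with parameters in $(G;+,-,0,<)$. $k_p$ is the maximal $n$ such that there are definable convex subgroups $A_0\subsetneq\dots\subsetneq A_{n-1}\subsetneq A_n=G$ with $[A_{i+1}/A_i:p(A_{i+1}/A_i)]=\infty$ for all $i<n$. -}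

module Defs where

open import Data.Nat as ℕ using (ℕ; zero; suc)
open import Data.Fin using (Fin)
open import Data.Nat.Primality using (Prime)
open import Data.List using (List)
open import Data.List.Relation.Unary.Any using (Any)
open import Data.Product using (Σ; ∃; _×_; _,_)
open import Data.Sum using (_⊎_)
open import Data.Unit using (⊤)
open import Data.Empty using (⊥)
open import Relation.Nullary using (¬_)
open import Relation.Binary.PropositionalEquality using (_≡_; _≢_)

record OrderedAbelianGroup : Set₁ where
  field
    Carrier : Set
    _+_     : Carrier → Carrier → Carrier
    -_      : Carrier → Carrier
    0#      : Carrier
    _<_     : Carrier → Carrier → Set
    +-assoc    : ∀ x y z → (x + y) + z ≡ x + (y + z)
    +-comm     : ∀ x y → x + y ≡ y + x
    +-identityˡ : ∀ x → 0# + x ≡ x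
    -‿inverseˡ : ∀ x → (- x) + x ≡ 0#
    <-irrefl   : ∀ x → ¬ (x < x)
    <-trans    : ∀ {x y z} → x < y → y < z → x < z
    <-trichotomy : ∀ x y → (x < y) ⊎ (x ≡ y) ⊎ (y < x)
    <-+-mono   : ∀ {x y} z → x < y → (x + z) < (y + z)

  infixl 6 _+_ _-_
  infix 4 _<_ _≤_

  _-_ : Carrier → Carrier → Carrier
  x - y = x + (- y)

  _≤_ : Carrier → Carrier → Set
  x ≤ y = (x < y) ⊎ (x ≡ y)

  _·_ : ℕ → Carrier → Carrier
  zero  · x = 0#
  suc n · x = x + (n · x)

data ℕ∞ : Set where
  fin : ℕ → ℕ∞
  ∞   : ℕ∞

data _<∞_ : ℕ∞ → ℕ∞ → Set where
  fin<fin : ∀ {m n} → m ℕ.< n → fin m <∞ fin n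
  fin<∞   : ∀ {m} → fin m <∞ ∞

data Card : Set where
  fin : ℕ → Card
  ω   : Card

_<κ_ : ℕ → Card → Set
i <κ fin n = i ℕ.< n
i <κ ω     = ⊤

data Term : Set where
  var  : ℕ → Term
  zer  : Term
  plus : Term → Term → Term
  neg  : Term → Term
  minus : Term → Term → Term

data Formula : Set where
  eq  : Term → Term → Formula
  lt  : Term → Term → Formula
  fls : Formula
  not : Formula → Formula
  and : Formula → Formula → Formula
  or  : Formula → Formula → Formula
  imp : Formula → Formula → Formula
  all : Formula → Formula   -- binds variable 0
  ex  : Formula → Formula

module _ (G : OrderedAbelianGroup) where
  open OrderedAbelianGroup G

  Env : Set
  Env = ℕ → Carrier

  _∷ₑ_ : Carrier → Env → Env
  (x ∷ₑ ρ) zero    = x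
  (x ∷ₑ ρ) (suc n) = ρ n

  ⟦_⟧ₜ : Term → Env → Carrier
  ⟦ var n ⟧ₜ ρ     = ρ n
  ⟦ zer ⟧ₜ ρ       = 0#
  ⟦ plus s t ⟧ₜ ρ  = ⟦ s ⟧ₜ ρ + ⟦ t ⟧ₜ ρ
  ⟦ neg t ⟧ₜ ρ     = - ⟦ t ⟧ₜ ρ
  ⟦ minus s t ⟧ₜ ρ = ⟦ s ⟧ₜ ρ - ⟦ t ⟧ₜ ρ

  Sat : Formula → Env → Set
  Sat (eq s t) ρ  = ⟦ s ⟧ₜ ρ ≡ ⟦ t ⟧ₜ ρ
  Sat (lt s t) ρ  = ⟦ s ⟧ₜ ρ < ⟦ t ⟧ₜ ρ
  Sat fls ρ       = ⊥
  Sat (not φ) ρ   = ¬ Sat φ ρ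
  Sat (and φ ψ) ρ = Sat φ ρ × Sat ψ ρ
  Sat (or φ ψ) ρ  = Sat φ ρ ⊎ Sat ψ ρ
  Sat (imp φ ψ) ρ = Sat φ ρ → Sat ψ ρ
  Sat (all φ) ρ   = ∀ x → Sat φ (x ∷ₑ ρ)
  Sat (ex φ) ρ    = Σ Carrier λ x → Sat φ (x ∷ₑ ρ)

  Pred : Set₁
  Pred = Carrier → Set

  _⊆_ : Pred → Pred → Set
  A ⊆ B = ∀ x → A x → B x

  _≐_ : Pred → Pred → Set
  A ≐ B = A ⊆ B × B ⊆ A

  _⊊_ : Pred → Pred → Set
  A ⊊ B = A ⊆ B × Σ Carrier λ x → B x × ¬ A x

  -- definable with parameters: X = { x : φ(x, ρ) } for some formula φ
  -- (free variable 0 is x, the other variables are parameters from ρ)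
  Definable : Pred → Set
  Definable X = Σ Formula λ φ → Σ Env λ ρ → ∀ x → (X x → Sat φ (x ∷ₑ ρ)) × (Sat φ (x ∷ₑ ρ) → X x)

  record IsConvexSubgroup (H : Pred) : Set where
    field
      0∈    : H 0#
      +-closed : ∀ {x y} → H x → H y → H (x + y)
      neg-closed : ∀ {x} → H x → H (- x)
      convex : ∀ {a b} → H a → 0# ≤ b → b ≤ a → H b

  DefConvex : Pred → Set
  DefConvex H = Definable H × IsConvexSubgroup H

  _+⟨_⟩G : Pred → ℕ → Pred
  (H +⟨ n ⟩G) x = Σ Carrier λ h → Σ Carrier λ g → H h × x ≡ h + (n · g)

  ⟨_⟩G : ℕ → Pred
  (⟨ n ⟩G) x = Σ Carrier λ g → x ≡ n · g

  _+⟨_^_⟩G : Pred → ℕ → ℕ∞ → Pred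
  H +⟨ p ^ fin k ⟩G = H +⟨ p ℕ.^ k ⟩G
  H +⟨ p ^ ∞ ⟩G     = H

  IndexInfinite : Pred → Pred → Set
  IndexInfinite A B = ∀ m → Σ (Fin m → Carrier) λ f →
    (∀ i → A (f i)) × (∀ i j → i ≢ j → ¬ B (f i - f j))

  IsH : ℕ → Carrier → Pred → Set₁
  IsH n a H =
      (⟨ n ⟩G a × H ≐ (λ x → x ≡ 0#))
    ⊎ (¬ ⟨ n ⟩G a × IsConvexSubgroup H × ¬ (H +⟨ n ⟩G) a
        × (∀ H' → IsConvexSubgroup H' → ¬ (H' +⟨ n ⟩G) a → H' ⊆ H))

  FiniteSpines : Set₁
  FiniteSpines = ∀ p → Prime p → Σ (List Pred) λ L →
    ∀ a H → IsH p a H → Any (λ K → K ≐ H) L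

  -- a chain A_0 ⊊ ... ⊊ A_n = G of definable convex subgroups with
  -- [A_{i+1}/A_i : p(A_{i+1}/A_i)] = ∞, i.e. [A_{i+1} : A_i + p A_{i+1}] = ∞
  PChain : ℕ → ℕ → Set₁
  PChain p n = Σ (ℕ → Pred) λ A →
      (∀ i → i ℕ.≤ n → DefConvex (A i))
    × (∀ x → A n x)
    × (∀ i → i ℕ.< n →
         A i ⊊ A (suc i)
       × IndexInfinite (A (suc i))
           (λ x → Σ Carrier λ a → Σ Carrier λ g →
              A i a × A (suc i) g × x ≡ a + (p · g)))

  IsKp : ℕ → ℕ → Set₁
  IsKp p n = PChain p n × (∀ m → PChain p m → m ℕ.≤ n)

  Cap : ℕ → Card → (ℕ → Pred) → (ℕ → ℕ∞) → Pred
  Cap p κ H e x = ∀ i → i <κ κ → (H i +⟨ p ^ e i ⟩G) x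

  CapExcept : ℕ → Card → (ℕ → Pred) → (ℕ → ℕ∞) → ℕ → Pred
  CapExcept p κ H e i₀ x = ∀ i → i <κ κ → i ≢ i₀ → (H i +⟨ p ^ e i ⟩G) x

module Submission where

-- No Hᵢ + p^eᵢ G contains the intersection of the others. Since Hᵢ + p⁰G = G, and
-- Hᵢ + p^eᵢ G ⊆ Hⱼ + p^eⱼ G whenever Hᵢ ⊆ Hⱼ and eⱼ ≤ eᵢ, this forces eᵢ ≠ 0 and e strictly
-- increasing. For i + 1 < κ, splitting the elements of ⋂_{j ≠ i} along Hᵢ₊₁ gives
-- [B : Hᵢ + p^eᵢ B] = ∞ for every subgroup B ⊇ Hᵢ₊₁, and as each (Hᵢ + pᵏB)/(Hᵢ + pᵏ⁺¹B) is an
-- image of B/(Hᵢ + pB) under pᵏ, even [B : Hᵢ + pB] = ∞. Taking B = Hᵢ₊₁ (and B = G at the top)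
-- yields a chain of length κ - 1, so κ ≤ k_p + 1. Taking B = Hᵢ₊₁ also yields cᵢ ∈ Hᵢ₊₁ outside
-- Hᵢ + pG; the spines H_p(cᵢ) contain Hᵢ but not Hᵢ₊₁, so they are pairwise distinct and finite
-- spines exclude κ = ω.

open import Defs hiding (_⊆_; _+⟨_⟩G; ⟨_⟩G; _+⟨_^_⟩G)
open import Level using (0ℓ)
open import Axiom.ExcludedMiddle using (ExcludedMiddle)
open import Axiom.DoubleNegationElimination using (em⇒dne)
open import Algebra.Bundles using (AbelianGroup)
import Algebra.Properties.AbelianGroup as AbelianGroupProperties
import Algebra.Properties.CommutativeSemigroup as CommutativeSemigroupProperties
open import Data.Nat as ℕ using (ℕ; zero; suc; _*_; _∸_; z≤n; s≤s)
import Data.Nat.Properties as ℕₚ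
open import Data.Nat.Primality using (Prime; ¬prime[0])
open import Data.Fin using (Fin; toℕ; inject≤) renaming (zero to fzero; suc to fsuc)
open import Data.Fin.Properties using (inject≤-injective; pigeonhole)
open import Data.List using (List; []; _∷_; length; map; filter; tabulate; lookup)
open import Data.List.Properties using (length-map; length-tabulate)
open import Data.List.Relation.Unary.All as All using (All)
import Data.List.Relation.Unary.All.Properties as Allₚ
open import Data.List.Relation.Unary.AllPairs as AllPairs using (AllPairs; []; _∷_)
import Data.List.Relation.Unary.AllPairs.Properties as AllPairsₚ
import Data.List.Relation.Unary.Any as Any
open import Data.List.Relation.Unary.Any.Properties using (lookup-result)
open import Data.List.Membership.Propositional.Properties using (∈-lookup)
open import Data.List.Relation.Binary.Sublist.Propositional
  using ([]; _∷_; _∷ʳ_; minimum; ⊆-trans) renaming (_⊆_ to _⊑_)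
open import Data.List.Relation.Binary.Sublist.Propositional.Properties using (All-resp-⊆; filter-⊆)
open import Data.Product using (Σ; _×_; _,_; proj₁; proj₂)
open import Data.Sum using (_⊎_; inj₁; inj₂; [_,_])
open import Data.Unit using (⊤; tt)
open import Data.Empty using (⊥; ⊥-elim)
open import Function using (_∘_)
open import Relation.Nullary using (¬_; yes; no)
open import Relation.Nullary.Decidable using (map′)
open import Relation.Unary using () renaming (Decidable to Decidable₁)
open import Relation.Unary.Properties using (∁?)
open import Relation.Binary.Definitions using (Decidable; Symmetric; tri<; tri≈; tri>)
open import Relation.Binary.PropositionalEquality
  using (_≡_; _≢_; refl; sym; trans; cong; cong₂; subst; subst₂; isEquivalence; module ≡-Reasoning)

<∞-irrefl : ∀ {a} → ¬ a <∞ a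
<∞-irrefl (fin<fin m<m) = ℕₚ.<-irrefl refl m<m

<∞-asym : ∀ {a b} → a <∞ b → ¬ b <∞ a
<∞-asym (fin<fin m<n) (fin<fin n<m) = ℕₚ.<-asym m<n n<m

∞≮ : ∀ {a} → ¬ ∞ <∞ a
∞≮ ()

fin<fin⁻¹ : ∀ {m n} → fin m <∞ fin n → m ℕ.< n
fin<fin⁻¹ (fin<fin m<n) = m<n

_<∞?_ : Decidable _<∞_
fin m <∞? fin n = map′ fin<fin fin<fin⁻¹ (m ℕ.<? n)
fin m <∞? ∞     = yes fin<∞
∞     <∞? b     = no ∞≮

≤-<κ : ∀ {i j} κ → i ℕ.≤ j → j <κ κ → i <κ κ
≤-<κ (fin n) i≤j j<n = ℕₚ.≤-<-trans i≤j j<n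
≤-<κ ω       _   _   = tt

module Notation (G : OrderedAbelianGroup) where
  infix 4 _⊆_
  infixl 6 _+⟨_⟩G _+⟨_^_⟩G

  _⊆_ : Pred G → Pred G → Set
  A ⊆ B = Defs._⊆_ G A B

  _+⟨_⟩G : Pred G → ℕ → Pred G
  H +⟨ n ⟩G = Defs._+⟨_⟩G G H n

  _+⟨_^_⟩G : Pred G → ℕ → ℕ∞ → Pred G
  H +⟨ p ^ e ⟩G = Defs._+⟨_^_⟩G G H p e

  ⟨_⟩G : ℕ → Pred G
  ⟨ n ⟩G = Defs.⟨_⟩G G n

module OrderedAbelianGroupProperties (G : OrderedAbelianGroup) where
  open OrderedAbelianGroup G

  +-identityʳ : ∀ x → x + 0# ≡ x
  +-identityʳ x = trans (+-comm x 0#) (+-identityˡ x)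

  -‿inverseʳ : ∀ x → x - x ≡ 0#
  -‿inverseʳ x = trans (+-comm x (- x)) (-‿inverseˡ x)

  +-abelianGroup : AbelianGroup 0ℓ 0ℓ
  +-abelianGroup = record
    { Carrier = Carrier ; _≈_ = _≡_ ; _∙_ = _+_ ; ε = 0# ; _⁻¹ = -_
    ; isAbelianGroup = record
      { isGroup = record
        { isMonoid = record
          { isSemigroup = record
            { isMagma = record { isEquivalence = isEquivalence ; ∙-cong = cong₂ _+_ }
            ; assoc = +-assoc }
          ; identity = +-identityˡ , +-identityʳ }
        ; inverse = -‿inverseˡ , -‿inverseʳ
        ; ⁻¹-cong = cong (-_) }
      ; comm = +-comm } }

  open AbelianGroupProperties +-abelianGroup public
    using ()
    renaming (⁻¹-involutive to neg-involutive; ε⁻¹≈ε to neg-0; ⁻¹-anti-homo‿- to neg-sub;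
              xyx⁻¹≈y to +-sub-cancelˡ)
  open AbelianGroupProperties +-abelianGroup using (⁻¹-∙-comm)
  open CommutativeSemigroupProperties (AbelianGroup.commutativeSemigroup +-abelianGroup)
    using (interchange)

  neg-distrib-+ : ∀ x y → - (x + y) ≡ - x + - y
  neg-distrib-+ x y = sym (⁻¹-∙-comm x y)

  sub-distrib-+ : ∀ a b c d → (a + b) - (c + d) ≡ (a - c) + (b - d)
  sub-distrib-+ a b c d = trans (cong ((a + b) +_) (neg-distrib-+ c d)) (interchange a b (- c) (- d))

  sub-cancelʳ : ∀ x y z → (x - z) - (y - z) ≡ x - y
  sub-cancelʳ x y z = begin
    (x - z) - (y - z)       ≡⟨ sub-distrib-+ x (- z) y (- z) ⟩
    (x - y) + (- z - - z)   ≡⟨ cong ((x - y) +_) (-‿inverseʳ (- z)) ⟩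
    (x - y) + 0#            ≡⟨ +-identityʳ (x - y) ⟩
    x - y                   ∎
    where open ≡-Reasoning

  ·-zeroʳ : ∀ n → n · 0# ≡ 0#
  ·-zeroʳ zero    = refl
  ·-zeroʳ (suc n) = trans (+-identityˡ (n · 0#)) (·-zeroʳ n)

  ·-identityˡ : ∀ x → 1 · x ≡ x
  ·-identityˡ = +-identityʳ

  ·-homo-+ : ∀ m n x → (m ℕ.+ n) · x ≡ m · x + n · x
  ·-homo-+ zero    n x = sym (+-identityˡ (n · x))
  ·-homo-+ (suc m) n x = trans (cong (x +_) (·-homo-+ m n x)) (sym (+-assoc x (m · x) (n · x)))

  ·-assoc : ∀ m n x → m · (n · x) ≡ (m * n) · x
  ·-assoc zero    n x = refl
  ·-assoc (suc m) n x = trans (cong (n · x +_) (·-assoc m n x)) (sym (·-homo-+ n (m * n) x))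

  ·-distrib-+ : ∀ n x y → n · (x + y) ≡ n · x + n · y
  ·-distrib-+ zero    x y = sym (+-identityˡ 0#)
  ·-distrib-+ (suc n) x y = trans (cong ((x + y) +_) (·-distrib-+ n x y)) (interchange x y (n · x) (n · y))

  ·-neg : ∀ n x → n · (- x) ≡ - (n · x)
  ·-neg zero    x = sym neg-0
  ·-neg (suc n) x = trans (cong (- x +_) (·-neg n x)) (sym (neg-distrib-+ x (n · x)))

  ·-distrib-sub : ∀ n x y → n · (x - y) ≡ n · x - n · y
  ·-distrib-sub n x y = trans (·-distrib-+ n x (- y)) (cong (n · x +_) (·-neg n y))

  +·-zeroʳ : ∀ n x → x + n · 0# ≡ x
  +·-zeroʳ n x = trans (cong (x +_) (·-zeroʳ n)) (+-identityʳ x)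

  +·-sub : ∀ n h g h′ g′ → (h + n · g) - (h′ + n · g′) ≡ (h - h′) + n · (g - g′)
  +·-sub n h g h′ g′ =
    trans (sub-distrib-+ h (n · g) h′ (n · g′)) (cong ((h - h′) +_) (sym (·-distrib-sub n g g′)))

  +·-assoc : ∀ n a b c → a + n · (b + c) ≡ (a + n · b) + n · c
  +·-assoc n a b c = trans (cong (a +_) (·-distrib-+ n b c)) (sym (+-assoc a (n · b) (n · c)))

  ≤-trans : ∀ {x y z} → x ≤ y → y ≤ z → x ≤ z
  ≤-trans (inj₁ x<y) (inj₁ y<z) = inj₁ (<-trans x<y y<z)
  ≤-trans (inj₁ x<y) (inj₂ refl) = inj₁ x<y
  ≤-trans (inj₂ refl) y≤z        = y≤z

  ≤-antisym : ∀ {x y} → x ≤ y → y ≤ x → x ≡ y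
  ≤-antisym (inj₂ x≡y) _          = x≡y
  ≤-antisym (inj₁ x<y) (inj₂ y≡x) = sym y≡x
  ≤-antisym (inj₁ x<y) (inj₁ y<x) = ⊥-elim (<-irrefl _ (<-trans x<y y<x))

  ≤-total : ∀ x y → x ≤ y ⊎ y ≤ x
  ≤-total x y with <-trichotomy x y
  ... | inj₁ x<y        = inj₁ (inj₁ x<y)
  ... | inj₂ (inj₁ x≡y) = inj₁ (inj₂ x≡y)
  ... | inj₂ (inj₂ y<x) = inj₂ (inj₁ y<x)

  +-monoˡ-≤ : ∀ {x y} z → x ≤ y → x + z ≤ y + z
  +-monoˡ-≤ z (inj₁ x<y)  = inj₁ (<-+-mono z x<y)
  +-monoˡ-≤ z (inj₂ refl) = inj₂ refl

  +-monoʳ-≤ : ∀ {x y} z → x ≤ y → z + x ≤ z + y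
  +-monoʳ-≤ {x} {y} z x≤y = subst₂ _≤_ (+-comm x z) (+-comm y z) (+-monoˡ-≤ z x≤y)

  +-mono-≤ : ∀ {x y u v} → x ≤ y → u ≤ v → x + u ≤ y + v
  +-mono-≤ {y = y} {u} x≤y u≤v = ≤-trans (+-monoˡ-≤ u x≤y) (+-monoʳ-≤ y u≤v)

  neg-anti-≤ : ∀ {x y} → x ≤ y → - y ≤ - x
  neg-anti-≤ {x} {y} x≤y = subst₂ _≤_ (cancel x (- y)) cancel-y (+-monoˡ-≤ (- x + - y) x≤y)
    where
    cancel : ∀ u z → u + (- u + z) ≡ z
    cancel u z = trans (sym (+-assoc u (- u) z)) (trans (cong (_+ z) (-‿inverseʳ u)) (+-identityˡ z))
    cancel-y : y + (- x + - y) ≡ - x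
    cancel-y = trans (cong (y +_) (+-comm (- x) (- y))) (cancel y (- x))

  0≤x⊎0≤-x : ∀ x → 0# ≤ x ⊎ 0# ≤ - x
  0≤x⊎0≤-x x with ≤-total 0# x
  ... | inj₁ 0≤x = inj₁ 0≤x
  ... | inj₂ x≤0 = inj₂ (subst (_≤ - x) neg-0 (neg-anti-≤ x≤0))

  -x≤x : ∀ {x} → 0# ≤ x → - x ≤ x
  -x≤x 0≤x = ≤-trans (subst (_ ≤_) neg-0 (neg-anti-≤ 0≤x)) 0≤x

  ·-mono-≤ : ∀ n {x y} → x ≤ y → n · x ≤ n · y
  ·-mono-≤ zero    x≤y = inj₂ refl
  ·-mono-≤ (suc n) x≤y = +-mono-≤ x≤y (·-mono-≤ n x≤y)

  x≤suc·x : ∀ n {x} → 0# ≤ x → x ≤ suc n · x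
  x≤suc·x n {x} 0≤x =
    subst (_≤ suc n · x) (+-identityʳ x) (+-monoʳ-≤ x (subst (_≤ n · x) (·-zeroʳ n) (·-mono-≤ n 0≤x)))

module Subgroups (G : OrderedAbelianGroup) where
  open OrderedAbelianGroup G
  open OrderedAbelianGroupProperties G
  open Notation G

  NegClosed : Pred G → Set
  NegClosed X = ∀ {x} → X x → X (- x)

  SubClosed : Pred G → Set
  SubClosed X = ∀ {x y} → X x → X y → X (x - y)

  record IsSubgroup (X : Pred G) : Set where
    field
      0∈         : X 0#
      +-closed   : ∀ {x y} → X x → X y → X (x + y)
      neg-closed : NegClosed X

    sub-closed : SubClosed X
    sub-closed x∈ y∈ = +-closed x∈ (neg-closed y∈)

    neg-closed⁻¹ : ∀ {x} → X (- x) → X x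
    neg-closed⁻¹ {x} -x∈ = subst X (neg-involutive x) (neg-closed -x∈)

    ·-closed : ∀ n {x} → X x → X (n · x)
    ·-closed zero    x∈ = 0∈
    ·-closed (suc n) x∈ = +-closed x∈ (·-closed n x∈)

  open IsSubgroup public

  convex⇒subgroup : ∀ {X} → IsConvexSubgroup G X → IsSubgroup X
  convex⇒subgroup X-convex = record { 0∈ = X.0∈ ; +-closed = X.+-closed ; neg-closed = X.neg-closed }
    where module X = IsConvexSubgroup X-convex

  torsion-free : ∀ {X} → IsConvexSubgroup G X → ∀ n {y} → n ≢ 0 → X (n · y) → X y
  torsion-free X-convex zero n≢0 _ = ⊥-elim (n≢0 refl)
  torsion-free {X} X-convex (suc n) {y} _ ny∈ =
    [ (λ 0≤y → X.convex ny∈ 0≤y (x≤suc·x n 0≤y))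
    , (λ 0≤-y → neg-closed⁻¹ (convex⇒subgroup X-convex) (X.convex n[-y]∈ 0≤-y (x≤suc·x n 0≤-y)))
    ] (0≤x⊎0≤-x y)
    where
    module X = IsConvexSubgroup X-convex
    n[-y]∈ : X (suc n · (- y))
    n[-y]∈ = subst X (sym (·-neg (suc n) y)) (X.neg-closed ny∈)

  infixl 6 _+[_]_

  _+[_]_ : Pred G → ℕ → Pred G → Pred G
  (H +[ n ] B) x = Σ Carrier λ h → Σ Carrier λ g → H h × B g × x ≡ h + n · g

  ⊆+[] : ∀ {H B} n → IsSubgroup B → H ⊆ H +[ n ] B
  ⊆+[] n B-subgroup x x∈ = x , 0# , x∈ , 0∈ B-subgroup , sym (+·-zeroʳ n x)

  +[]-neg-closed : ∀ {H B} n → IsSubgroup H → IsSubgroup B → NegClosed (H +[ n ] B)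
  +[]-neg-closed n H-subgroup B-subgroup (h , g , h∈ , g∈ , refl) =
    - h , - g , neg-closed H-subgroup h∈ , neg-closed B-subgroup g∈ ,
    trans (neg-distrib-+ h (n · g)) (cong (- h +_) (sym (·-neg n g)))

  +⟨⟩G-sub-closed : ∀ {H} n → IsSubgroup H → SubClosed (H +⟨ n ⟩G)
  +⟨⟩G-sub-closed n H-subgroup (h , g , h∈ , refl) (h′ , g′ , h′∈ , refl) =
    h - h′ , g - g′ , sub-closed H-subgroup h∈ h′∈ , +·-sub n h g h′ g′

  +⟨^⟩G-sub-closed : ∀ {H} p e → IsSubgroup H → SubClosed (H +⟨ p ^ e ⟩G)
  +⟨^⟩G-sub-closed p (fin k) = +⟨⟩G-sub-closed (p ℕ.^ k)
  +⟨^⟩G-sub-closed p ∞       = sub-closed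

  ⊆+⟨^⟩G : ∀ {H} p e → IsSubgroup H → H ⊆ H +⟨ p ^ e ⟩G
  ⊆+⟨^⟩G p (fin k) H-subgroup x x∈ = x , 0# , x∈ , sym (+·-zeroʳ (p ℕ.^ k) x)
  ⊆+⟨^⟩G p ∞       H-subgroup x x∈ = x∈

  +⟨^⟩G-mono : ∀ {H H′} p {d d′} → H ⊆ H′ → IsSubgroup H′ → ¬ d <∞ d′ → H +⟨ p ^ d ⟩G ⊆ H′ +⟨ p ^ d′ ⟩G
  +⟨^⟩G-mono p {∞}     {d′}     H⊆H′ H′-subgroup _ x x∈ = ⊆+⟨^⟩G p d′ H′-subgroup x (H⊆H′ x x∈)
  +⟨^⟩G-mono p {fin a} {∞}      H⊆H′ H′-subgroup d≮d′ = ⊥-elim (d≮d′ fin<∞)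
  +⟨^⟩G-mono p {fin a} {fin b}  H⊆H′ H′-subgroup d≮d′ x (h , g , h∈ , refl) =
    h , (p ℕ.^ (a ∸ b)) · g , H⊆H′ h h∈ ,
    cong (h +_) (trans (cong (_· g) p^a≡) (sym (·-assoc (p ℕ.^ b) (p ℕ.^ (a ∸ b)) g)))
    where
    p^a≡ : p ℕ.^ a ≡ p ℕ.^ b * p ℕ.^ (a ∸ b)
    p^a≡ = trans (cong (p ℕ.^_) (sym (ℕₚ.m+[n∸m]≡n (ℕₚ.≮⇒≥ (d≮d′ ∘ fin<fin)))))
                 (ℕₚ.^-distribˡ-+-* p b (a ∸ b))

  +⟨⟩G-difference : ∀ {H H′ B} n {x y} (x∈ : (H +⟨ n ⟩G) x) (y∈ : (H +⟨ n ⟩G) y) →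
    (H′ +[ n ] B) (proj₁ x∈ - proj₁ y∈) → (H′ +⟨ n ⟩G) (x - y)
  +⟨⟩G-difference n (h , w , _ , refl) (h′ , w′ , _ , refl) (c , d , c∈ , _ , h-h′≡) =
    c , d + (w - w′) , c∈ , (begin
      (h + n · w) - (h′ + n · w′)   ≡⟨ +·-sub n h w h′ w′ ⟩
      (h - h′) + n · (w - w′)       ≡⟨ cong (_+ n · (w - w′)) h-h′≡ ⟩
      (c + n · d) + n · (w - w′)    ≡⟨ +·-assoc n c d (w - w′) ⟨
      c + n · (d + (w - w′))        ∎)
    where open ≡-Reasoning

  +⟨⟩G∩⊆+[] : ∀ {H B} n → IsConvexSubgroup G B → n ≢ 0 → H ⊆ B →
    ∀ {x} → B x → (H +⟨ n ⟩G) x → (H +[ n ] B) x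
  +⟨⟩G∩⊆+[] {B = B} n B-convex n≢0 H⊆B x∈ (h , g , h∈ , refl) =
    h , g , h∈ , torsion-free B-convex n n≢0 ng∈ , refl
    where
    ng∈ : B (n · g)
    ng∈ = subst B (+-sub-cancelˡ h (n · g)) (sub-closed (convex⇒subgroup B-convex) x∈ (H⊆B h h∈))

  whole : Pred G
  whole _ = ⊤

  whole-defConvex : DefConvex G whole
  whole-defConvex =
    (eq zer zer , (λ _ → 0#) , λ _ → (λ _ → refl) , (λ _ → tt)) ,
    record { 0∈ = tt ; +-closed = λ _ _ → tt ; neg-closed = λ _ → tt ; convex = λ _ _ _ → tt }

  whole-chain : ∀ p → PChain G p 0
  whole-chain p = (λ _ → whole) , (λ _ _ → whole-defConvex) , (λ _ → tt) , λ _ ()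

module _ {X : Set} where

  AllPairs-resp-⊑ : ∀ {R : X → X → Set} {xs ys} → xs ⊑ ys → AllPairs R ys → AllPairs R xs
  AllPairs-resp-⊑ []         []          = []
  AllPairs-resp-⊑ (y ∷ʳ τ)   (_ ∷ Rys)   = AllPairs-resp-⊑ τ Rys
  AllPairs-resp-⊑ (refl ∷ τ) (Ry ∷ Rys)  = All-resp-⊆ τ Ry ∷ AllPairs-resp-⊑ τ Rys

  lookup-All : ∀ {P : X → Set} {xs} → All P xs → ∀ i → P (lookup xs i)
  lookup-All Pxs i = All.lookup Pxs (∈-lookup i)

  lookup-AllPairs : ∀ {R : X → X → Set} → Symmetric R → ∀ {xs} → AllPairs R xs →
    ∀ {i j} → i ≢ j → R (lookup xs i) (lookup xs j)
  lookup-AllPairs R-sym (Rx ∷ Rxs) {fzero}  {fzero}  i≢j = ⊥-elim (i≢j refl)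
  lookup-AllPairs R-sym (Rx ∷ Rxs) {fzero}  {fsuc j} i≢j = lookup-All Rx j
  lookup-AllPairs R-sym (Rx ∷ Rxs) {fsuc i} {fzero}  i≢j = R-sym (lookup-All Rx i)
  lookup-AllPairs R-sym (Rx ∷ Rxs) {fsuc i} {fsuc j} i≢j = lookup-AllPairs R-sym Rxs (i≢j ∘ cong fsuc)

  length-filter+∁ : ∀ {P : X → Set} (P? : Decidable₁ P) xs →
    length xs ≡ length (filter P? xs) ℕ.+ length (filter (∁? P?) xs)
  length-filter+∁ P? []       = refl
  length-filter+∁ P? (x ∷ xs) with P? x
  ... | yes _ = cong suc (length-filter+∁ P? xs)
  ... | no _  = trans (cong suc (length-filter+∁ P? xs)) (sym (ℕₚ.+-suc _ _))

  module _ (R : X → X → Set) (R? : Decidable R) where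

    Spread : ℕ → List X → Set
    Spread M xs = Σ (List X) λ ys → ys ⊑ xs × AllPairs (λ x y → ¬ R x y) ys × M ℕ.≤ length ys

    Cluster : ℕ → List X → Set
    Cluster K xs = Σ X λ x → Σ (List X) λ ys → ys ⊑ xs × All (R x) ys × K ℕ.≤ length ys

    spread-or-cluster : ∀ M K xs → M * suc K ℕ.≤ length xs → Spread M xs ⊎ Cluster K xs
    spread-or-cluster zero    K xs       _              = inj₁ ([] , minimum xs , [] , z≤n)
    spread-or-cluster (suc M) K (x ∷ xs) (s≤s K+MK≤∣xs∣) with K ℕ.≤? length (filter (R? x) xs)
    ... | yes K≤ = inj₂ (x , filter (R? x) xs , x ∷ʳ filter-⊆ (R? x) xs , Allₚ.all-filter (R? x) xs , K≤)
    ... | no  K≰ with spread-or-cluster M K unrelated MK≤∣unrelated∣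
      where
      unrelated = filter (∁? (R? x)) xs
      MK≤∣unrelated∣ : M * suc K ℕ.≤ length unrelated
      MK≤∣unrelated∣ = ℕₚ.+-cancelˡ-≤ K _ _ (ℕₚ.≤-trans K+MK≤∣xs∣ (ℕₚ.≤-trans
        (ℕₚ.≤-reflexive (length-filter+∁ (R? x) xs))
        (ℕₚ.+-monoˡ-≤ (length unrelated) (ℕₚ.<⇒≤ (ℕₚ.≰⇒> K≰)))))
    ...   | inj₁ (ys , τ , ys-spread , M≤) =
      inj₁ (x ∷ ys , refl ∷ ⊆-trans τ (filter-⊆ _ xs) , All-resp-⊆ τ (Allₚ.all-filter _ xs) ∷ ys-spread , s≤s M≤)
    ...   | inj₂ (z , ys , τ , ys-related , K≤) =
      inj₂ (z , ys , x ∷ʳ ⊆-trans τ (filter-⊆ _ xs) , ys-related , K≤)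

module IndexProperties (G : OrderedAbelianGroup) where
  open OrderedAbelianGroup G
  open OrderedAbelianGroupProperties G
  open Notation G
  open Subgroups G

  index-infinite⇒∃∉ : ∀ {A B} → SubClosed A → IndexInfinite G A B → Σ Carrier λ x → A x × ¬ B x
  index-infinite⇒∃∉ A-sub-closed ∞AB with ∞AB 2
  ... | f , f∈A , f-apart =
    f fzero - f (fsuc fzero) , A-sub-closed (f∈A fzero) (f∈A (fsuc fzero)) , f-apart fzero (fsuc fzero) λ ()

  index-infinite⇒⊊ : ∀ {A′ A B} → A′ ⊆ A → A′ ⊆ B → SubClosed A → IndexInfinite G A B → _⊊_ G A′ A
  index-infinite⇒⊊ A′⊆A A′⊆B A-sub-closed ∞AB with index-infinite⇒∃∉ A-sub-closed ∞AB
  ... | x , x∈A , x∉B = A′⊆A , x , x∈A , x∉B ∘ A′⊆B x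

  index-infinite-map : ∀ {A B A′ B′} (f : ∀ x → A x → Carrier) → (∀ x a → A′ (f x a)) →
    (∀ {x y} a b → B′ (f x a - f y b) → B (x - y)) → IndexInfinite G A B → IndexInfinite G A′ B′
  index-infinite-map f f∈A′ f-reflects ∞AB M with ∞AB M
  ... | g , g∈A , g-apart =
    (λ i → f (g i) (g∈A i)) , (λ i → f∈A′ _ (g∈A i)) ,
    λ i j i≢j → g-apart i j i≢j ∘ f-reflects (g∈A i) (g∈A j)

  Apart : Pred G → Carrier → Carrier → Set
  Apart B x y = ¬ B (y - x)

  apart-sym : ∀ {B} → NegClosed B → Symmetric (Apart B)
  apart-sym {B} B-neg-closed {x} {y} y-x∉B x-y∈B = y-x∉B (subst B (neg-sub x y) (B-neg-closed x-y∈B))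

  Family : Pred G → Pred G → ℕ → Set
  Family A B M = Σ (List Carrier) λ xs → All A xs × AllPairs (Apart B) xs × M ℕ.≤ length xs

  index-infinite⇒family : ∀ {A B} → IndexInfinite G A B → ∀ M → Family A B M
  index-infinite⇒family ∞AB M with ∞AB M
  ... | f , f∈A , f-apart =
    tabulate f , Allₚ.tabulate⁺ f∈A , AllPairsₚ.tabulate⁺ (λ {i} {j} i≢j → f-apart j i (i≢j ∘ sym)) ,
    ℕₚ.≤-reflexive (sym (length-tabulate f))

  family⇒index-infinite : ∀ {A B} → NegClosed B → (∀ M → Family A B M) → IndexInfinite G A B
  family⇒index-infinite {B = B} B-neg-closed family M with family M
  ... | xs , xs∈A , xs-apart , M≤∣xs∣ =
    f , (λ i → lookup-All xs∈A (index i)) ,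
    λ i j i≢j → lookup-AllPairs (apart-sym {B} B-neg-closed) xs-apart {index j} {index i}
                  (i≢j ∘ sym ∘ inject≤-injective M≤∣xs∣ M≤∣xs∣ j i)
    where
    index = λ (i : Fin M) → inject≤ i M≤∣xs∣
    f = λ i → lookup xs (index i)

  -- [A : B] ≤ [A : C] [C : B]: of M (K + 1) elements pairwise apart modulo B, either M are pairwise
  -- apart modulo C or K lie in a single coset of C.
  index-infinite-split : ExcludedMiddle 0ℓ → ∀ {A B C} → NegClosed B → NegClosed C →
    IndexInfinite G A B → IndexInfinite G A C ⊎ IndexInfinite G C B
  index-infinite-split lem {A} {B} {C} B-neg-closed C-neg-closed ∞AB with lem {Σ ℕ λ M → ¬ Family A C M}
  ... | no ¬bounded = inj₁ (family⇒index-infinite {A} {C} C-neg-closed λ M → em⇒dne lem (¬bounded ∘ (M ,_)))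
  ... | yes (M , ¬family) = inj₂ (family⇒index-infinite {C} {B} B-neg-closed cluster)
    where
    cluster : ∀ K → Family C B K
    cluster K with index-infinite⇒family {A} {B} ∞AB (M * suc K)
    ... | xs , xs∈A , xs-apart , N≤∣xs∣
      with spread-or-cluster (λ x y → C (y - x)) (λ _ _ → lem) M K xs N≤∣xs∣
    ...   | inj₁ (ys , τ , ys-spread , M≤) = ⊥-elim (¬family (ys , All-resp-⊆ τ xs∈A , ys-spread , M≤))
    ...   | inj₂ (x , ys , τ , ys-C , K≤) =
      map (_- x) ys , Allₚ.map⁺ ys-C ,
      AllPairsₚ.map⁺ (AllPairs.map (λ {y} {z} → subst (¬_ ∘ B) (sym (sub-cancelʳ z y x)))
                                  (AllPairs-resp-⊑ τ xs-apart)) ,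
      ℕₚ.≤-trans K≤ (ℕₚ.≤-reflexive (sym (length-map (_- x) ys)))

  module _ {H B : Pred G} (H-subgroup : IsSubgroup H) (B-subgroup : IsSubgroup B) where

    +[]-divide : ∀ n m → IndexInfinite G (H +[ n ] B) (H +[ n * m ] B) → IndexInfinite G B (H +[ m ] B)
    +[]-divide n m =
      index-infinite-map {H +[ n ] B} {H +[ n * m ] B} {B} {H +[ m ] B}
        (λ _ → proj₁ ∘ proj₂) (λ _ → proj₁ ∘ proj₂ ∘ proj₂ ∘ proj₂) reflects
      where
      reflects : ∀ {x y} (x∈ : (H +[ n ] B) x) (y∈ : (H +[ n ] B) y) →
        (H +[ m ] B) (proj₁ (proj₂ x∈) - proj₁ (proj₂ y∈)) → (H +[ n * m ] B) (x - y)
      reflects (h , g , h∈ , _ , refl) (h′ , g′ , h′∈ , _ , refl) (c , d , c∈ , d∈ , g-g′≡) =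
        (h - h′) + n · c , d ,
        +-closed H-subgroup (sub-closed H-subgroup h∈ h′∈) (·-closed H-subgroup n c∈) , d∈ ,
        (begin
          (h + n · g) - (h′ + n · g′)       ≡⟨ +·-sub n h g h′ g′ ⟩
          (h - h′) + n · (g - g′)           ≡⟨ cong (λ t → (h - h′) + n · t) g-g′≡ ⟩
          (h - h′) + n · (c + m · d)        ≡⟨ +·-assoc n (h - h′) c (m · d) ⟩
          ((h - h′) + n · c) + n · (m · d)  ≡⟨ cong ((h - h′) + n · c +_) (·-assoc n m d) ⟩
          ((h - h′) + n · c) + (n * m) · d  ∎)
        where open ≡-Reasoning

    -- [B : H + pᵏ⁺²B] ≤ [B : H + pB] [H + pB : H + pᵏ⁺²B] ≤ [B : H + pB] [B : H + pᵏ⁺¹B].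
    index-infinite-p^ : ExcludedMiddle 0ℓ → ∀ p k →
      IndexInfinite G B (H +[ p ℕ.^ suc k ] B) → IndexInfinite G B (H +[ p ] B)
    index-infinite-p^ lem p zero    = subst (λ n → IndexInfinite G B (H +[ n ] B)) (ℕₚ.*-identityʳ p)
    index-infinite-p^ lem p (suc k) infinite
      with index-infinite-split lem {B} {H +[ p ℕ.^ suc (suc k) ] B} {H +[ p ] B}
             (+[]-neg-closed (p ℕ.^ suc (suc k)) H-subgroup B-subgroup)
             (+[]-neg-closed p H-subgroup B-subgroup) infinite
    ... | inj₁ infinite-mod-p = infinite-mod-p
    ... | inj₂ infinite-in-p  = index-infinite-p^ lem p k (+[]-divide p (p ℕ.^ suc k) infinite-in-p)

module Spine (G : OrderedAbelianGroup) where
  open OrderedAbelianGroup G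
  open OrderedAbelianGroupProperties G
  open Notation G
  open Subgroups G

  -- For 0 ≤ x this is the convex subgroup generated by x.
  Hull : Carrier → Pred G
  Hull x z = Σ ℕ λ k → z ≤ k · x × - z ≤ k · x

  hull-mono : ∀ {x y} → x ≤ y → Hull x ⊆ Hull y
  hull-mono x≤y z (k , z≤kx , -z≤kx) = k , ≤-trans z≤kx (·-mono-≤ k x≤y) , ≤-trans -z≤kx (·-mono-≤ k x≤y)

  hull-neg : ∀ {x z} → Hull x z → Hull x (- z)
  hull-neg {x} {z} (k , z≤kx , -z≤kx) = k , -z≤kx , subst (_≤ k · x) (sym (neg-involutive z)) z≤kx

  hull-self : ∀ {x} → 0# ≤ x → Hull x x
  hull-self {x} 0≤x = 1 , inj₂ (sym (·-identityˡ x)) , subst (- x ≤_) (sym (·-identityˡ x)) (-x≤x 0≤x)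

  hull-zero : ∀ {z} → Hull 0# z → z ≡ 0#
  hull-zero {z} (k , z≤k0 , -z≤k0) = ≤-antisym (subst (z ≤_) (·-zeroʳ k) z≤k0) 0≤z
    where
    0≤z : 0# ≤ z
    0≤z = subst₂ _≤_ neg-0 (neg-involutive z) (neg-anti-≤ (subst (- z ≤_) (·-zeroʳ k) -z≤k0))

  hull-+ : ∀ {x y} → y ≤ x → Hull (x + y) ⊆ Hull x
  hull-+ {x} {y} y≤x z (k , z≤ , -z≤) = k ℕ.+ k , ≤-trans z≤ k[x+y]≤ , ≤-trans -z≤ k[x+y]≤
    where
    k[x+y]≤ : k · (x + y) ≤ (k ℕ.+ k) · x
    k[x+y]≤ = subst₂ _≤_ (sym (·-distrib-+ k x y)) (sym (·-homo-+ k k x))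
                         (+-monoʳ-≤ (k · x) (·-mono-≤ k y≤x))

  hull⊆ : ∀ {K x} → IsConvexSubgroup G K → K x → Hull x ⊆ K
  hull⊆ K-convex x∈ z (k , z≤kx , -z≤kx) =
    [ (λ 0≤z → K.convex kx∈ 0≤z z≤kx)
    , (λ 0≤-z → neg-closed⁻¹ K-subgroup (K.convex kx∈ 0≤-z -z≤kx))
    ] (0≤x⊎0≤-x z)
    where
    module K = IsConvexSubgroup K-convex
    K-subgroup = convex⇒subgroup K-convex
    kx∈ = ·-closed K-subgroup k x∈

  module _ (n : ℕ) (b : Carrier) (b∉nG : ¬ ⟨ n ⟩G b) where

    Catches : Carrier → Set
    Catches x = (Hull x +⟨ n ⟩G) b

    catches-mono : ∀ {x y} → Hull x ⊆ Hull y → Catches x → Catches y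
    catches-mono Hx⊆Hy (z , g , z∈ , b≡) = z , g , Hx⊆Hy z z∈ , b≡

    ¬catches-0 : ¬ Catches 0#
    ¬catches-0 (z , g , z∈ , b≡) =
      b∉nG (g , trans b≡ (trans (cong (_+ n · g) (hull-zero z∈)) (+-identityˡ (n · g))))

    catches-+ : ∀ x y → Catches (x + y) → Catches x ⊎ Catches y
    catches-+ x y x+y-catches with ≤-total x y
    ... | inj₁ x≤y =
      inj₂ (catches-mono (λ z → hull-+ x≤y z ∘ subst (λ w → Hull w z) (+-comm x y)) x+y-catches)
    ... | inj₂ y≤x = inj₁ (catches-mono (hull-+ y≤x) x+y-catches)

    spine : Pred G
    spine x = ¬ Catches x × ¬ Catches (- x)

    spine-isConvexSubgroup : IsConvexSubgroup G spine
    spine-isConvexSubgroup = record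
      { 0∈         = ¬catches-0 , ¬catches-0 ∘ subst Catches neg-0
      ; +-closed   = λ {x} {y} (¬cx , ¬c-x) (¬cy , ¬c-y) →
          [ ¬cx , ¬cy ] ∘ catches-+ x y ,
          [ ¬c-x , ¬c-y ] ∘ catches-+ (- x) (- y) ∘ subst Catches (neg-distrib-+ x y)
      ; neg-closed = λ {x} (¬cx , ¬c-x) → ¬c-x , ¬cx ∘ subst Catches (neg-involutive x)
      ; convex     = λ {a} {c} (¬ca , _) 0≤c c≤a →
          ¬ca ∘ catches-mono (hull-mono c≤a) , ¬ca ∘ catches-mono (hull-mono (≤-trans (-x≤x 0≤c) c≤a))
      }

    spine-avoids : ¬ (spine +⟨ n ⟩G) b
    spine-avoids (s , g , (¬cs , ¬c-s) , b≡) with 0≤x⊎0≤-x s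
    ... | inj₁ 0≤s  = ¬cs (s , g , hull-self 0≤s , b≡)
    ... | inj₂ 0≤-s = ¬c-s (s , g , subst (Hull (- s)) (neg-involutive s) (hull-neg (hull-self 0≤-s)) , b≡)

    spine-greatest : ∀ K → IsConvexSubgroup G K → ¬ (K +⟨ n ⟩G) b → K ⊆ spine
    spine-greatest K K-convex b∉K+nG x x∈ = ¬catches x∈ , ¬catches (IsConvexSubgroup.neg-closed K-convex x∈)
      where
      ¬catches : ∀ {y} → K y → ¬ Catches y
      ¬catches y∈ (z , g , z∈ , b≡) = b∉K+nG (z , g , hull⊆ K-convex y∈ z z∈ , b≡)

    spine-isH : IsH G n b spine
    spine-isH = inj₂ (b∉nG , spine-isConvexSubgroup , spine-avoids , spine-greatest)


  module _ (spines : FiniteSpines G) {p} (p-prime : Prime p) (c : ℕ → Carrier) (S : ℕ → Pred G)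
    (S-isH : ∀ i → IsH G p (c i) (S i)) where

    private
      L : List (Pred G)
      L = proj₁ (spines p p-prime)

      S∈L : ∀ i → Any.Any (λ K → _≐_ G K (S i)) L
      S∈L i = proj₂ (spines p p-prime) (c i) (S i) (S-isH i)

    spines-collide : Σ ℕ λ i → Σ ℕ λ j → i ℕ.< j × S j ⊆ S i
    spines-collide with pigeonhole (ℕₚ.n<1+n (length L)) (Any.index ∘ S∈L ∘ toℕ)
    ... | i , j , i<j , same-index = toℕ i , toℕ j , i<j , λ x x∈Sⱼ →
      proj₁ (lookup-result (S∈L (toℕ i))) x
        (subst (λ K → K x) (cong (lookup L) (sym same-index)) (proj₂ (lookup-result (S∈L (toℕ j))) x x∈Sⱼ))

module Irredundant (lem : ExcludedMiddle 0ℓ) (G : OrderedAbelianGroup) (p : ℕ) (κ : Card)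
  (H : ℕ → Pred G) (e : ℕ → ℕ∞)
  (H-defConvex : ∀ i → i <κ κ → DefConvex G (H i))
  (H-strict : ∀ i j → i <κ κ → j <κ κ → i ℕ.< j → _⊊_ G (H i) (H j))
  (H-index : ∀ i₀ → i₀ <κ κ → IndexInfinite G (CapExcept G p κ H e i₀) (Cap G p κ H e)) where
  open OrderedAbelianGroup G
  open OrderedAbelianGroupProperties G
  open Notation G
  open Subgroups G
  open IndexProperties G
  open Spine G

  H-convex : ∀ i → i <κ κ → IsConvexSubgroup G (H i)
  H-convex i i<κ = proj₂ (H-defConvex i i<κ)

  H-subgroup : ∀ i → i <κ κ → IsSubgroup (H i)
  H-subgroup i i<κ = convex⇒subgroup (H-convex i i<κ)

  H+pᵉG : ℕ → Pred G
  H+pᵉG i = H i +⟨ p ^ e i ⟩G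

  ⋂ : Pred G
  ⋂ = Cap G p κ H e

  ⋂≠ : ℕ → Pred G
  ⋂≠ = CapExcept G p κ H e

  ⋂≠-sub-closed : ∀ i → SubClosed (⋂≠ i)
  ⋂≠-sub-closed i x∈ y∈ j j<κ j≢i =
    +⟨^⟩G-sub-closed p (e j) (H-subgroup j j<κ) (x∈ j j<κ j≢i) (y∈ j j<κ j≢i)

  ⋂≠-∩ : ∀ {i x} → ⋂≠ i x → H+pᵉG i x → ⋂ x
  ⋂≠-∩ {i} x∈ x∈ᵢ j j<κ with j ℕ.≟ i
  ... | yes refl = x∈ᵢ
  ... | no  j≢i  = x∈ j j<κ j≢i

  not-redundant : ∀ i → i <κ κ → ¬ ⋂≠ i ⊆ H+pᵉG i
  not-redundant i i<κ ⋂≠⊆ with index-infinite⇒∃∉ (⋂≠-sub-closed i) (H-index i i<κ)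
  ... | x , x∈ , x∉ = x∉ (⋂≠-∩ x∈ (⋂≠⊆ x x∈))

  e≢0 : ∀ i → i <κ κ → e i ≢ fin 0
  e≢0 i i<κ eᵢ≡0 = not-redundant i i<κ λ x _ →
    subst (λ d → (H i +⟨ p ^ d ⟩G) x) (sym eᵢ≡0)
      (0# , x , 0∈ (H-subgroup i i<κ) , sym (trans (+-identityˡ (1 · x)) (·-identityˡ x)))

  <⇒<∞ : ∀ i j → i <κ κ → j <κ κ → i ℕ.< j → e i <∞ e j
  <⇒<∞ i j i<κ j<κ i<j with e i <∞? e j
  ... | yes eᵢ<eⱼ = eᵢ<eⱼ
  ... | no  eᵢ≮eⱼ = ⊥-elim (not-redundant j j<κ λ x x∈ →
    +⟨^⟩G-mono p (proj₁ (H-strict i j i<κ j<κ i<j)) (H-subgroup j j<κ) eᵢ≮eⱼ x (x∈ i i<κ (ℕₚ.<⇒≢ i<j)))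

  <∞⇒< : ∀ i j → i <κ κ → j <κ κ → e i <∞ e j → i ℕ.< j
  <∞⇒< i j i<κ j<κ eᵢ<eⱼ with ℕₚ.<-cmp i j
  ... | tri< i<j _ _  = i<j
  ... | tri≈ _ refl _ = ⊥-elim (<∞-irrefl eᵢ<eⱼ)
  ... | tri> _ _ j<i  = ⊥-elim (<∞-asym eᵢ<eⱼ (<⇒<∞ j i j<κ i<κ j<i))

  ∞⇒maximal : ∀ i₀ → i₀ <κ κ → e i₀ ≡ ∞ → ∀ j → j <κ κ → j ℕ.≤ i₀
  ∞⇒maximal i₀ i₀<κ eᵢ₀≡∞ j j<κ with j ℕ.≤? i₀
  ... | yes j≤i₀ = j≤i₀
  ... | no  j≰i₀ = ⊥-elim (∞≮ (subst (_<∞ e j) eᵢ₀≡∞ (<⇒<∞ i₀ j i₀<κ j<κ (ℕₚ.≰⇒> j≰i₀))))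

  e-finite : ∀ i → suc i <κ κ → Σ ℕ λ k → e i ≡ fin (suc k)
  e-finite i i+1<κ with e i in eᵢ≡
  ... | fin zero    = ⊥-elim (e≢0 i (≤-<κ κ (ℕₚ.n≤1+n i) i+1<κ) eᵢ≡)
  ... | fin (suc k) = k , refl
  ... | ∞           = ⊥-elim (ℕₚ.1+n≰n (∞⇒maximal i (≤-<κ κ (ℕₚ.n≤1+n i) i+1<κ) eᵢ≡ (suc i) i+1<κ))

  -- Write the elements of ⋂≠ i as h + p^eᵢ w with h ∈ H (suc i): the components h are pairwise
  -- apart modulo H i + p^eᵢ B, and the exponent is then lowered to 1 by index-infinite-p^.
  step-index : ∀ i → suc i <κ κ → ∀ {B} → IsSubgroup B → H (suc i) ⊆ B → IndexInfinite G B (H i +[ p ] B)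
  step-index i i+1<κ {B} B-subgroup Hᵢ₊₁⊆B with e-finite i i+1<κ
  ... | k , eᵢ≡ = index-infinite-p^ (H-subgroup i i<κ) B-subgroup lem p k
        (index-infinite-map {⋂≠ i} {⋂} {B} {H i +[ q ] B} part part∈B reflects (H-index i i<κ))
    where
    i<κ = ≤-<κ κ (ℕₚ.n≤1+n i) i+1<κ
    q = p ℕ.^ suc k

    eᵢ₊₁≮eᵢ : ¬ e (suc i) <∞ fin (suc k)
    eᵢ₊₁≮eᵢ = <∞-asym (subst (_<∞ e (suc i)) eᵢ≡ (<⇒<∞ i (suc i) i<κ i+1<κ (ℕₚ.n<1+n i)))

    decompose : ∀ {x} → ⋂≠ i x → (H (suc i) +⟨ q ⟩G) x
    decompose x∈ =
      +⟨^⟩G-mono p (λ _ h∈ → h∈) (H-subgroup (suc i) i+1<κ) eᵢ₊₁≮eᵢ _ (x∈ (suc i) i+1<κ ℕₚ.1+n≢n)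

    part : ∀ x → ⋂≠ i x → Carrier
    part _ = proj₁ ∘ decompose

    part∈B : ∀ x x∈ → B (part x x∈)
    part∈B _ x∈ = Hᵢ₊₁⊆B _ (proj₁ (proj₂ (proj₂ (decompose x∈))))

    reflects : ∀ {x y} x∈ y∈ → (H i +[ q ] B) (part x x∈ - part y y∈) → ⋂ (x - y)
    reflects {x} {y} x∈ y∈ d∈ = ⋂≠-∩ (⋂≠-sub-closed i x∈ y∈)
      (subst (λ d → (H i +⟨ p ^ d ⟩G) (x - y)) (sym eᵢ≡)
        (+⟨⟩G-difference {H (suc i)} {H i} {B} q (decompose x∈) (decompose y∈) d∈))

  module Unbounded (all<κ : ∀ i → i <κ κ) (p≢0 : p ≢ 0) where

    H-mono : ∀ {i j} → i ℕ.≤ j → H i ⊆ H j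
    H-mono {i} {j} i≤j with ℕₚ.m≤n⇒m<n∨m≡n i≤j
    ... | inj₁ i<j  = proj₁ (H-strict i j (all<κ i) (all<κ j) i<j)
    ... | inj₂ refl = λ _ x∈ → x∈

    separator : ∀ i → Σ Carrier λ c → H (suc i) c × ¬ (H i +⟨ p ⟩G) c
    separator i with index-infinite⇒∃∉ (sub-closed (H-subgroup (suc i) (all<κ (suc i)))) Hᵢ₊₁-index
      where Hᵢ₊₁-index = step-index i (all<κ (suc i)) (H-subgroup (suc i) (all<κ (suc i))) λ _ x∈ → x∈
    ... | c , c∈ , c∉ =
      c , c∈ , c∉ ∘ +⟨⟩G∩⊆+[] p (H-convex (suc i) (all<κ (suc i))) p≢0 (H-mono (ℕₚ.n≤1+n i)) c∈

    c : ℕ → Carrier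
    c = proj₁ ∘ separator

    c∉Hᵢ+pG : ∀ i → ¬ (H i +⟨ p ⟩G) (c i)
    c∉Hᵢ+pG = proj₂ ∘ proj₂ ∘ separator

    c∉pG : ∀ i → ¬ ⟨ p ⟩G (c i)
    c∉pG i (g , c≡) =
      c∉Hᵢ+pG i (0# , g , 0∈ (H-subgroup i (all<κ i)) , trans c≡ (sym (+-identityˡ (p · g))))

    S : ℕ → Pred G
    S i = spine p (c i) (c∉pG i)

    -- c i lies in H (suc i) ⊆ S j but not in S i.
    S-⊈ : ∀ {i j} → i ℕ.< j → ¬ S j ⊆ S i
    S-⊈ {i} {j} i<j Sⱼ⊆Sᵢ = spine-avoids p (c i) (c∉pG i) (c i , 0# , Sⱼ⊆Sᵢ (c i) cᵢ∈Sⱼ , sym (+·-zeroʳ p (c i)))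
      where
      cᵢ∈Sⱼ : S j (c i)
      cᵢ∈Sⱼ = spine-greatest p (c j) (c∉pG j) (H j) (H-convex j (all<κ j)) (c∉Hᵢ+pG j) (c i)
                (H-mono i<j (c i) (proj₁ (proj₂ (separator i))))

  unbounded-impossible : (∀ i → i <κ κ) → FiniteSpines G → Prime p → ⊥
  unbounded-impossible all<κ spines p-prime =
    let i , j , i<j , Sⱼ⊆Sᵢ = spines-collide spines p-prime c S (λ i → spine-isH p (c i) (c∉pG i))
    in  S-⊈ i<j Sⱼ⊆Sᵢ
    where
    p≢0 : p ≢ 0
    p≢0 p≡0 = ¬prime[0] (subst Prime p≡0 p-prime)
    open Unbounded all<κ p≢0

  module Chain (m : ℕ) (m<κ : m <κ κ) where

    A : ℕ → Pred G
    A j with j ℕ.<? m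
    ... | yes _ = H j
    ... | no  _ = whole

    A≡H : ∀ {j} → j ℕ.< m → A j ≡ H j
    A≡H {j} j<m with j ℕ.<? m
    ... | yes _   = refl
    ... | no  j≮m = ⊥-elim (j≮m j<m)

    A-defConvex : ∀ j → j ℕ.≤ m → DefConvex G (A j)
    A-defConvex j j≤m with j ℕ.<? m
    ... | yes j<m = H-defConvex j (≤-<κ κ j≤m m<κ)
    ... | no  _   = whole-defConvex

    A-subgroup : ∀ j → j ℕ.≤ m → IsSubgroup (A j)
    A-subgroup j j≤m = convex⇒subgroup (proj₂ (A-defConvex j j≤m))

    A-whole : ∀ x → A m x
    A-whole x with m ℕ.<? m
    ... | yes m<m = ⊥-elim (ℕₚ.<-irrefl refl m<m)
    ... | no  _   = tt

    H⊆A : ∀ {j} → H j ⊆ A j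
    H⊆A {j} x x∈ with j ℕ.<? m
    ... | yes _ = x∈
    ... | no  _ = tt

    A-index : ∀ i → i ℕ.< m → IndexInfinite G (A (suc i)) (A i +[ p ] A (suc i))
    A-index i i<m = subst (λ Aᵢ → IndexInfinite G (A (suc i)) (Aᵢ +[ p ] A (suc i))) (sym (A≡H i<m))
      (step-index i (≤-<κ κ i<m m<κ) (A-subgroup (suc i) i<m) H⊆A)

    A-strict : ∀ i → i ℕ.< m → _⊊_ G (A i) (A (suc i))
    A-strict i i<m =
      index-infinite⇒⊊ Aᵢ⊆Aᵢ₊₁ (⊆+[] p Aᵢ₊₁-subgroup) (sub-closed Aᵢ₊₁-subgroup) (A-index i i<m)
      where
      Aᵢ₊₁-subgroup = A-subgroup (suc i) i<m
      Hᵢ⊆Hᵢ₊₁ = proj₁ (H-strict i (suc i) (≤-<κ κ (ℕₚ.<⇒≤ i<m) m<κ) (≤-<κ κ i<m m<κ) (ℕₚ.n<1+n i))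
      Aᵢ⊆Aᵢ₊₁ : A i ⊆ A (suc i)
      Aᵢ⊆Aᵢ₊₁ x x∈ = H⊆A x (Hᵢ⊆Hᵢ₊₁ x (subst (λ Aᵢ → Aᵢ x) (A≡H i<m) x∈))

    chain : PChain G p m
    chain = A , A-defConvex , A-whole , λ i i<m → A-strict i i<m , A-index i i<m

  length-bound : FiniteSpines G → Prime p →
    Σ ℕ λ m → κ ≡ fin m × PChain G p (m ∸ 1) × (∀ n → IsKp G p n → m ℕ.≤ suc n)
  length-bound spines p-prime = bound κ refl
    where
    bound : ∀ κ′ → κ ≡ κ′ → Σ ℕ λ m → κ ≡ fin m × PChain G p (m ∸ 1) × (∀ n → IsKp G p n → m ℕ.≤ suc n)
    bound ω           κ≡ω = ⊥-elim (unbounded-impossible (λ i → subst (i <κ_) (sym κ≡ω) tt) spines p-prime)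
    bound (fin zero)    κ≡0 = 0 , κ≡0 , whole-chain p , λ _ _ → z≤n
    bound (fin (suc m)) κ≡m+1 = suc m , κ≡m+1 , chain , λ n (_ , maximal) → s≤s (maximal m chain)
      where open Chain m (subst (m <κ_) (sym κ≡m+1) (ℕₚ.n<1+n m))

open import Data.Nat using (_<_; _≤_)

proposition4p15 : (lem : ∀ ℓ → ExcludedMiddle ℓ)
    → (G : OrderedAbelianGroup) → FiniteSpines G
    → (p : ℕ) → Prime p
    → (κ : Card) (H : ℕ → Pred G) (e : ℕ → ℕ∞)
    → (∀ i → i <κ κ → DefConvex G (H i))
    → (∀ i j → i <κ κ → j <κ κ → i < j → _⊊_ G (H i) (H j))
    → (∀ i₀ → i₀ <κ κ → IndexInfinite G (CapExcept G p κ H e i₀) (Cap G p κ H e))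
    → ((∀ i → i <κ κ → e i ≢ fin 0)
       × (∀ i₀ → i₀ <κ κ → e i₀ ≡ ∞ → ∀ j → j <κ κ → j ≤ i₀))
      × (∀ i j → i <κ κ → j <κ κ → (i < j → e i <∞ e j) × (e i <∞ e j → i < j))
      × Σ ℕ (λ m → κ ≡ fin m × PChain G p (m ∸ 1) × (∀ n → IsKp G p n → m ≤ suc n))
proposition4p15 lem G spines p p-prime κ H e H-defConvex H-strict H-index =
  (e≢0 , ∞⇒maximal) ,
  (λ i j i<κ j<κ → <⇒<∞ i j i<κ j<κ , <∞⇒< i j i<κ j<κ) ,
  length-bound spines p-prime
  where open Irredundant (lem 0ℓ) G p κ H e H-defConvex H-strict H-index
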